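{- A $d$-pseudomanifold $X$ is normal if and only if it satisfies the link condition, i.e. $lk(x,X)$ is connected for every $p$-face $x$ of $X$ with $p\le d-2$.
   Context: A simplex is a non-empty finite set; its dimension is its cardinality minus one. A complex is a finite set $X$ of simplexes closed under taking non-empty subsets; elements are faces; facets are faces maximal for inclusion. A subset $S\subseteq X$ is open if $x\in S$, $y\in X$, $x\subseteq y$ imply $y\in S$. A path in a set of simplexes is a sequence of its elements with consecutive elements comparable for inclusion; a set is connected if any two elements are joined by a path in it. A $p$-pair is a pair $(x,y)$ with $x\subseteq y$, $\dim y=p$, $\dim x=p-1$; a strong $p$-path is a path whose consecutive elements form $p$-pairs in one order or the other. A set $S$ is $d$-pure if all its facets have dimension $d$; a $d$-pure $S$ is strongly connected if any two facets of $S$ are joined by a strong $d$-path in $S$. A $d$-pseudomanifold is a $d$-pure complex that is non-branching (each $(d-1)$-face lies in exactly two $d$-faces) and strongly connected. A $d$-pseudomanifold is normal if it is connected, $d\ge1$, and every connected open subset of it is strongly connected. The link of a face $x$ of $X$ is $lk(x,X)=\{y\in X: x\cap y=\emptyset,\ x\cup y\in X\}$. -}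

module Defs where

open import Data.Nat using (ℕ; zero; suc; _≤_; _+_)
open import Data.Bool using (Bool; true; false; _∧_)
open import Data.Bool.Properties using () renaming (_≟_ to _≟ᵇ_)
open import Data.Vec.Properties using (≡-dec)
open import Data.Fin.Subset using (Subset; _⊆_; _∩_; _∪_; ∣_∣; Nonempty; ⊥)
open import Data.Product using (_×_; Σ; ∃; _,_)
open import Data.Sum using (_⊎_)
open import Relation.Nullary using (¬_; does)
open import Relation.Binary.PropositionalEquality using (_≡_; _≢_)

-- Vertices are drawn from Fin n; a (candidate) simplex is a subset of Fin n,
-- and it is a simplex when it is nonempty.  A finite set of simplexes is a
-- Boolean-valued (hence decidable, finite) subset of Subset n.
SSet : ℕ → Set
SSet n = Subset n → Bool

module _ {n : ℕ} where

  infix 4 _∈ₛ_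
  _∈ₛ_ : Subset n → SSet n → Set
  x ∈ₛ S = S x ≡ true

  SetOfSimplexes : SSet n → Set
  SetOfSimplexes S = ∀ x → x ∈ₛ S → Nonempty x

  _⊆ₛ_ : SSet n → SSet n → Set
  S ⊆ₛ T = ∀ x → x ∈ₛ S → x ∈ₛ T

  Complex : SSet n → Set
  Complex X = SetOfSimplexes X
            × (∀ x y → x ∈ₛ X → y ⊆ x → Nonempty y → y ∈ₛ X)

  -- dimension: dim x = p  iff  ∣ x ∣ = p + 1
  -- open subset S of X
  Open : SSet n → SSet n → Set
  Open S X = S ⊆ₛ X × (∀ x y → x ∈ₛ S → y ∈ₛ X → x ⊆ y → y ∈ₛ S)

  data Path (R : Subset n → Subset n → Set) (S : SSet n) : Subset n → Subset n → Set where
    stop : ∀ {x} → x ∈ₛ S → Path R S x x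
    step : ∀ {x y z} → x ∈ₛ S → R x y → Path R S y z → Path R S x z

  Comparable : Subset n → Subset n → Set
  Comparable x y = x ⊆ y ⊎ y ⊆ x

  Connected : SSet n → Set
  Connected S = ∀ x y → x ∈ₛ S → y ∈ₛ S → Path Comparable S x y

  PPair : ℕ → Subset n → Subset n → Set
  PPair p x y = x ⊆ y × ∣ y ∣ ≡ suc p × ∣ x ∣ ≡ p

  StrongStep : ℕ → Subset n → Subset n → Set
  StrongStep p x y = PPair p x y ⊎ PPair p y x

  Facet : SSet n → Subset n → Set
  Facet S x = x ∈ₛ S × (∀ y → y ∈ₛ S → x ⊆ y → y ≡ x)

  Pure : ℕ → SSet n → Set
  Pure d S = ∀ x → Facet S x → ∣ x ∣ ≡ suc d

  StronglyConnected : ℕ → SSet n → Set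
  StronglyConnected d S =
    Pure d S × (∀ x y → Facet S x → Facet S y → Path (StrongStep d) S x y)

  DFaceOver : ℕ → SSet n → Subset n → Subset n → Set
  DFaceOver d X x y = y ∈ₛ X × ∣ y ∣ ≡ suc d × x ⊆ y

  NonBranching : ℕ → SSet n → Set
  NonBranching d X = ∀ x → x ∈ₛ X → ∣ x ∣ ≡ d →
    Σ (Subset n) λ y₁ → Σ (Subset n) λ y₂ →
      y₁ ≢ y₂ × DFaceOver d X x y₁ × DFaceOver d X x y₂ ×
      (∀ z → DFaceOver d X x z → z ≡ y₁ ⊎ z ≡ y₂)

  Pseudomanifold : ℕ → SSet n → Set
  Pseudomanifold d X =
    Complex X × Pure d X × NonBranching d X × StronglyConnected d X

  Normal : ℕ → SSet n → Set
  Normal d X = Connected X × 1 ≤ d ×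
    (∀ (S : SSet n) → Open S X → Connected S → StronglyConnected d S)

  lk : Subset n → SSet n → SSet n
  lk x X y = X y ∧ does (≡-dec _≟ᵇ_ (x ∩ y) ⊥) ∧ X (x ∪ y)

  LinkCondition : ℕ → SSet n → Set
  LinkCondition d X = ∀ (p : ℕ) (x : Subset n) → x ∈ₛ X → ∣ x ∣ ≡ suc p →
    p + 2 ≤ d → Connected (lk x X)

-- Both directions compare strong paths in an open set with paths in links.
-- Normal ⇒ link condition: the star of a face x is open and connected, hence
-- strongly connected, and z ↦ z ─ x turns a strong path between facets of the
-- star into a path in lk(x, X).
-- Link condition ⇒ normal: by downward induction on ∣ x ∣, any two facets
-- containing a face x of an open set T are joined by a strong path in T.  For
-- ∣ x ∣ ≥ d this is immediate; otherwise a path from F ─ x to G ─ x in the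
-- connected link lifts, step by step, to facets over the larger faces x ∪ y.
-- A path in a connected open set lifts in the same way.
module Submission where

open import Data.Bool using (true; _∧_)
open import Data.Bool.Properties using () renaming (_≟_ to _≟ᵇ_)
open import Data.Empty using (⊥-elim)
open import Data.Fin.Subset
open import Data.Fin.Subset.Induction using (⊃-wellFounded)
open import Data.Fin.Subset.Properties
open import Data.Nat using (ℕ; zero; suc; _≤_; _<_; _+_; _≤?_)
open import Data.Nat.Properties
  using (≤-trans; ≤-reflexive; <-≤-trans; <-irrefl; <⇒≱; ≰⇒>; n≤1+n; m≤n⇒m<n∨m≡n;
         m≤n+m; +-comm; +-suc; +-identityʳ; +-monoˡ-≤)
open import Data.Product using (_×_; ∃-syntax; _,_; proj₁; proj₂)
open import Data.Sum using (inj₁; inj₂)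
open import Data.Vec using (_∷_; here; there)
open import Data.Vec.Properties using (≡-dec)
open import Function.Bundles using (_⇔_; mk⇔)
open import Induction.WellFounded using (Acc; acc)
open import Relation.Nullary using (¬_; yes; no; does)
open import Relation.Nullary.Decidable using (dec-true; _×-dec_)
open import Relation.Binary.PropositionalEquality
  using (_≡_; refl; sym; cong; subst; subst₂)

open import Defs

x∈p─q⇒x∉q : ∀ {n} (p q : Subset n) {i} → i ∈ p ─ q → i ∉ q
x∈p─q⇒x∉q (_ ∷ p) (inside  ∷ q) ()        here
x∈p─q⇒x∉q (_ ∷ p) (_       ∷ q) (there h) (there h′) = x∈p─q⇒x∉q p q h h′

module _ {n : ℕ} where

  ⊆∧⊄⇒≡ : {p q : Subset n} → p ⊆ q → ¬ p ⊂ q → p ≡ q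
  ⊆∧⊄⇒≡ {p} {q} p⊆q p⊄q = ⊆-antisym p⊆q q⊆p
    where
    q⊆p : q ⊆ p
    q⊆p {i} i∈q with i ∈? p
    ... | yes i∈p = i∈p
    ... | no  i∉p = ⊥-elim (p⊄q (p⊆q , i , i∈q , i∉p))

  ⊆∧∣q∣≤∣p∣⇒≡ : {p q : Subset n} → p ⊆ q → ∣ q ∣ ≤ ∣ p ∣ → p ≡ q
  ⊆∧∣q∣≤∣p∣⇒≡ p⊆q ∣q∣≤∣p∣ = ⊆∧⊄⇒≡ p⊆q (λ p⊂q → <⇒≱ (p⊂q⇒∣p∣<∣q∣ p⊂q) ∣q∣≤∣p∣)

  ⊆∧∣p∣<∣q∣⇒⊂ : {p q : Subset n} → p ⊆ q → ∣ p ∣ < ∣ q ∣ → p ⊂ q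
  ⊆∧∣p∣<∣q∣⇒⊂ {p} {q} p⊆q ∣p∣<∣q∣ with p ⊂? q
  ... | yes p⊂q = p⊂q
  ... | no  p⊄q = ⊥-elim (<-irrefl (cong ∣_∣ (⊆∧⊄⇒≡ p⊆q p⊄q)) ∣p∣<∣q∣)

  nonempty⇒0<∣p∣ : {p : Subset n} → Nonempty p → 0 < ∣ p ∣
  nonempty⇒0<∣p∣ {p} (i , i∈p) =
    subst (_< ∣ p ∣) (∣⊥∣≡0 n) (p⊂q⇒∣p∣<∣q∣ (⊥⊆ , i , i∈p , ∉⊥))

  ─-monoˡ-⊆ : ∀ {p q : Subset n} r → p ⊆ q → p ─ r ⊆ q ─ r
  ─-monoˡ-⊆ {p} r p⊆q i∈p─r =
    x∈p∧x∉q⇒x∈p─q (p⊆q (p─q⊆p p r i∈p─r)) (x∈p─q⇒x∉q p r i∈p─r)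

  ∪-monoʳ-⊆ : ∀ p {q r : Subset n} → q ⊆ r → p ∪ q ⊆ p ∪ r
  ∪-monoʳ-⊆ p {q} {r} q⊆r i∈p∪q with x∈p∪q⁻ p q i∈p∪q
  ... | inj₁ i∈p = p⊆p∪q r i∈p
  ... | inj₂ i∈q = q⊆p∪q p r (q⊆r i∈q)

  p∪[q─p]≡q : {p q : Subset n} → p ⊆ q → p ∪ (q ─ p) ≡ q
  p∪[q─p]≡q {p} {q} p⊆q = ⊆-antisym ⊆q q⊆
    where
    ⊆q : p ∪ (q ─ p) ⊆ q
    ⊆q i∈ with x∈p∪q⁻ p (q ─ p) i∈
    ... | inj₁ i∈p   = p⊆q i∈p
    ... | inj₂ i∈q─p = p─q⊆p q p i∈q─p
    q⊆ : q ⊆ p ∪ (q ─ p)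
    q⊆ {i} i∈q with i ∈? p
    ... | yes i∈p = p⊆p∪q (q ─ p) i∈p
    ... | no  i∉p = q⊆p∪q p (q ─ p) (x∈p∧x∉q⇒x∈p─q i∈q i∉p)

  p∩[q─p]≡⊥ : ∀ (p q : Subset n) → p ∩ (q ─ p) ≡ ⊥
  p∩[q─p]≡⊥ p q = ⊆-antisym disjoint ⊥⊆
    where
    disjoint : p ∩ (q ─ p) ⊆ ⊥
    disjoint i∈ with x∈p∩q⁻ p (q ─ p) i∈
    ... | i∈p , i∈q─p = ⊥-elim (x∈p─q⇒x∉q q p i∈q─p i∈p)

  p∩q≡⊥⇒x∈p⇒x∉q : {p q : Subset n} → p ∩ q ≡ ⊥ → ∀ {i} → i ∈ p → i ∉ q
  p∩q≡⊥⇒x∈p⇒x∉q p∩q≡⊥ {i} i∈p i∈q = ∉⊥ (subst (i ∈_) p∩q≡⊥ (x∈p∩q⁺ (i∈p , i∈q)))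

  p∩q≡⊥⇒q⊆r─p : {p q r : Subset n} → p ∩ q ≡ ⊥ → p ∪ q ⊆ r → q ⊆ r ─ p
  p∩q≡⊥⇒q⊆r─p {p} {q} p∩q≡⊥ p∪q⊆r i∈q =
    x∈p∧x∉q⇒x∈p─q (p∪q⊆r (q⊆p∪q p q i∈q)) (λ i∈p → p∩q≡⊥⇒x∈p⇒x∉q p∩q≡⊥ i∈p i∈q)

  p∩q≡⊥⇒p⊂p∪q : {p q : Subset n} → p ∩ q ≡ ⊥ → Nonempty q → p ⊂ p ∪ q
  p∩q≡⊥⇒p⊂p∪q {p} {q} p∩q≡⊥ (i , i∈q) =
    p⊆p∪q q , i , q⊆p∪q p q i∈q , (λ i∈p → p∩q≡⊥⇒x∈p⇒x∉q p∩q≡⊥ i∈p i∈q)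

module _ {n : ℕ} {R : Subset n → Subset n → Set} {S : SSet n} where

  infixr 5 _++ₚ_
  _++ₚ_ : ∀ {x y z} → Path R S x y → Path R S y z → Path R S x z
  stop _        ++ₚ q = q
  step x∈S r p ++ₚ q = step x∈S r (p ++ₚ q)

  Path-head : ∀ {x y} → Path R S x y → x ∈ₛ S
  Path-head (stop x∈S)     = x∈S
  Path-head (step x∈S _ _) = x∈S

  Path-map : ∀ {R′ : Subset n → Subset n → Set} → (∀ {a b} → R a b → R′ a b) →
             ∀ {x y} → Path R S x y → Path R′ S x y
  Path-map f (stop x∈S)       = stop x∈S
  Path-map f (step x∈S r p) = step x∈S (f r) (Path-map f p)

module _ {n : ℕ} where

  StrongStep⇒Comparable : ∀ {d} {a b : Subset n} → StrongStep d a b → Comparable a b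
  StrongStep⇒Comparable (inj₁ (a⊆b , _)) = inj₁ a⊆b
  StrongStep⇒Comparable (inj₂ (b⊆a , _)) = inj₂ b⊆a

  StrongStep⇒d≤∣target∣ : ∀ {d} {a b : Subset n} → StrongStep d a b → d ≤ ∣ b ∣
  StrongStep⇒d≤∣target∣ {d} (inj₁ (_ , ∣b∣≡1+d , _)) = ≤-trans (n≤1+n d) (≤-reflexive (sym ∣b∣≡1+d))
  StrongStep⇒d≤∣target∣     (inj₂ (_ , _ , ∣b∣≡d))   = ≤-reflexive (sym ∣b∣≡d)

  facetAbove : (X : SSet n) → ∀ {y} → y ∈ₛ X → ∃[ F ] Facet X F × y ⊆ F
  facetAbove X {y} = go (⊃-wellFounded y)
    where
    go : ∀ {y} → Acc _⊃_ y → y ∈ₛ X → ∃[ F ] Facet X F × y ⊆ F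
    go {y} (acc rs) y∈X with anySubset? (λ z → (X z ≟ᵇ true) ×-dec (y ⊂? z))
    ... | yes (z , z∈X , y⊂z) with go (rs y⊂z) z∈X
    ...   | F , facetF , z⊆F = F , facetF , ⊆-trans (p⊂q⇒p⊆q y⊂z) z⊆F
    go {y} (acc rs) y∈X | no ∄z =
      y , (y∈X , λ z z∈X y⊆z → sym (⊆∧⊄⇒≡ y⊆z (λ y⊂z → ∄z (z , z∈X , y⊂z)))) , ⊆-refl

  Open⇒Facet : ∀ {S X : SSet n} {F} → Open S X → Facet S F → Facet X F
  Open⇒Facet (S⊆X , up) (F∈S , maximal) =
    S⊆X _ F∈S , λ z z∈X F⊆z → maximal z (up _ z F∈S z∈X F⊆z) F⊆z

  StronglyConnected⇒Connected : ∀ {d} {S : SSet n} → StronglyConnected d S → Connected S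
  StronglyConnected⇒Connected {S = S} (_ , join) a b a∈S b∈S
    with facetAbove S a∈S | facetAbove S b∈S
  ... | F , facetF , a⊆F | G , facetG , b⊆G =
    step a∈S (inj₁ a⊆F)
      (Path-map StrongStep⇒Comparable (join F G facetF facetG)
        ++ₚ step (proj₁ facetG) (inj₂ b⊆G) (stop b∈S))

  FacetsOverJoined : (Subset n → Subset n → Set) → SSet n → SSet n → Subset n → Set
  FacetsOverJoined R T X x =
    ∀ {F G} → Facet X F → Facet X G → x ⊆ F → x ⊆ G → Path R T F G

  module _ {R : Subset n → Subset n → Set} {T X A : SSet n}
           (f : Subset n → Subset n) (f-mono : ∀ {a b} → a ⊆ b → f a ⊆ f b)
           (f∈X : ∀ {a} → a ∈ₛ A → f a ∈ₛ X)
           (joined : ∀ {a} → a ∈ₛ A → FacetsOverJoined R T X (f a)) where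

    -- Each step a ~ b of the path is crossed through a facet H ⊇ f b, which
    -- also contains f a when a ⊆ b; otherwise F ⊇ f a ⊇ f b.
    joinAlong : ∀ {a b} → Path Comparable A a b →
                ∀ {F G} → Facet X F → Facet X G → f a ⊆ F → f b ⊆ G → Path R T F G
    joinAlong (stop a∈A) = joined a∈A
    joinAlong (step {x = a} {y = b} a∈A a~b rest) {F} facetF facetG fa⊆F fc⊆G
      with facetAbove X (f∈X (Path-head rest))
    ... | H , facetH , fb⊆H = toH a~b ++ₚ joinAlong rest facetH facetG fb⊆H fc⊆G
      where
      toH : Comparable a b → Path R T F H
      toH (inj₁ a⊆b) = joined a∈A facetF facetH fa⊆F (⊆-trans (f-mono a⊆b) fb⊆H)
      toH (inj₂ b⊆a) = joined (Path-head rest) facetF facetH (⊆-trans (f-mono b⊆a) fa⊆F) fb⊆H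

module LinkAndStar {n : ℕ} (X : SSet n) where

  ∈-lk⁺ : ∀ {x y} → y ∈ₛ X → x ∩ y ≡ ⊥ → x ∪ y ∈ₛ X → y ∈ₛ lk x X
  ∈-lk⁺ {x} {y} y∈X x∩y≡⊥ x∪y∈X
    rewrite y∈X | x∪y∈X | dec-true (≡-dec _≟ᵇ_ (x ∩ y) ⊥) x∩y≡⊥ = refl

  ∈-lk⁻ : ∀ {x y} → y ∈ₛ lk x X → y ∈ₛ X × x ∩ y ≡ ⊥ × x ∪ y ∈ₛ X
  ∈-lk⁻ {x} {y} y∈lk with X y | ≡-dec _≟ᵇ_ (x ∩ y) ⊥ | X (x ∪ y)
  ... | true | yes x∩y≡⊥ | true = refl , x∩y≡⊥ , refl

  star : Subset n → SSet n
  star x z = X z ∧ does (x ⊆? z)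

  ∈-star⁺ : ∀ {x z} → z ∈ₛ X → x ⊆ z → z ∈ₛ star x
  ∈-star⁺ {x} {z} z∈X x⊆z rewrite z∈X | dec-true (x ⊆? z) x⊆z = refl

  ∈-star⁻ : ∀ x {z} → z ∈ₛ star x → z ∈ₛ X × x ⊆ z
  ∈-star⁻ x {z} z∈St with X z | x ⊆? z
  ... | true | yes x⊆z = refl , x⊆z

  star-open : ∀ x → Open (star x) X
  star-open x = (λ _ z∈St → proj₁ (∈-star⁻ x z∈St))
              , λ a b a∈St b∈X a⊆b → ∈-star⁺ b∈X (⊆-trans (proj₂ (∈-star⁻ x a∈St)) a⊆b)

  star-connected : ∀ {x} → x ∈ₛ X → Connected (star x)
  star-connected {x} x∈X a b a∈St b∈St =
    step a∈St (inj₂ (proj₂ (∈-star⁻ x a∈St)))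
      (step (∈-star⁺ x∈X ⊆-refl) (inj₁ (proj₂ (∈-star⁻ x b∈St))) (stop b∈St))

  module _ (complex : Complex X) where

    ─∈lk : ∀ {x z} → x ⊂ z → z ∈ₛ X → z ─ x ∈ₛ lk x X
    ─∈lk {x} {z} (x⊆z , i , i∈z , i∉x) z∈X =
      ∈-lk⁺ (proj₂ complex z (z ─ x) z∈X (p─q⊆p z x) (i , x∈p∧x∉q⇒x∈p─q i∈z i∉x))
            (p∩[q─p]≡⊥ x z)
            (subst (_∈ₛ X) (sym (p∪[q─p]≡q x⊆z)) z∈X)

    ∈-lk⇒⊂∪ : ∀ {x y} → y ∈ₛ lk x X → x ⊂ x ∪ y
    ∈-lk⇒⊂∪ y∈lk with ∈-lk⁻ y∈lk
    ... | y∈X , x∩y≡⊥ , _ = p∩q≡⊥⇒p⊂p∪q x∩y≡⊥ (proj₁ complex _ y∈X)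

    LinkCondition⇒lk-connected : ∀ {d} → LinkCondition d X →
                                 ∀ {x} → x ∈ₛ X → ∣ x ∣ < d → Connected (lk x X)
    LinkCondition⇒lk-connected {d} LC {x} x∈X ∣x∣<d
      with ∣ x ∣ in ∣x∣≡ | nonempty⇒0<∣p∣ (proj₁ complex x x∈X)
    ... | suc p | _ = LC p x x∈X ∣x∣≡ (subst (_≤ d) (+-comm 2 p) ∣x∣<d)

module LinkCondition⇒Normal {n d : ℕ} {X : SSet n} (complex : Complex X) (pure : Pure d X)
                            (LC : LinkCondition d X) {T : SSet n} (T-open : Open T X) where

  open LinkAndStar X

  private
    up : ∀ {x y} → x ∈ₛ T → y ∈ₛ X → x ⊆ y → y ∈ₛ T
    up = proj₂ T-open _ _

  facetsOverLargeFace : ∀ {x} → x ∈ₛ T → d ≤ ∣ x ∣ → FacetsOverJoined (StrongStep d) T X x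
  facetsOverLargeFace {x} x∈T d≤∣x∣ {F} {G} facetF facetG x⊆F x⊆G
    with m≤n⇒m<n∨m≡n d≤∣x∣
  ... | inj₂ d≡∣x∣ =
    step (up x∈T (proj₁ facetF) x⊆F) (inj₂ (x⊆F , pure F facetF , sym d≡∣x∣))
      (step x∈T (inj₁ (x⊆G , pure G facetG , sym d≡∣x∣)) (stop (up x∈T (proj₁ facetG) x⊆G)))
  ... | inj₁ d<∣x∣ = subst₂ (Path (StrongStep d) T) (x≡ facetF x⊆F) (x≡ facetG x⊆G) (stop x∈T)
    where
    x≡ : ∀ {H} → Facet X H → x ⊆ H → x ≡ H
    x≡ {H} facetH x⊆H = ⊆∧∣q∣≤∣p∣⇒≡ x⊆H (subst (_≤ ∣ x ∣) (sym (pure H facetH)) d<∣x∣)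

  facetsOverFace′ : ∀ k {x} → x ∈ₛ T → d ≤ ∣ x ∣ + k → FacetsOverJoined (StrongStep d) T X x
  facetsOverFace′ zero x∈T d≤∣x∣+0 =
    facetsOverLargeFace x∈T (subst (d ≤_) (+-identityʳ _) d≤∣x∣+0)
  facetsOverFace′ (suc k) {x} x∈T d≤∣x∣+1+k with d ≤? ∣ x ∣
  ... | yes d≤∣x∣ = facetsOverLargeFace x∈T d≤∣x∣
  ... | no  d≰∣x∣ = λ facetF facetG x⊆F x⊆G →
    joinAlong (x ∪_) (∪-monoʳ-⊆ x) (λ y∈lk → proj₂ (proj₂ (∈-lk⁻ y∈lk))) overLink
      (LinkCondition⇒lk-connected complex LC x∈X ∣x∣<d _ _
        (─∈lk complex (x⊂ facetF x⊆F) (proj₁ facetF))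
        (─∈lk complex (x⊂ facetG x⊆G) (proj₁ facetG)))
      facetF facetG (⊆-reflexive (p∪[q─p]≡q x⊆F)) (⊆-reflexive (p∪[q─p]≡q x⊆G))
    where
    x∈X : x ∈ₛ X
    x∈X = proj₁ T-open x x∈T
    ∣x∣<d : ∣ x ∣ < d
    ∣x∣<d = ≰⇒> d≰∣x∣
    x⊂ : ∀ {H} → Facet X H → x ⊆ H → x ⊂ H
    x⊂ {H} facetH x⊆H =
      ⊆∧∣p∣<∣q∣⇒⊂ x⊆H (<-≤-trans ∣x∣<d (≤-trans (n≤1+n d) (≤-reflexive (sym (pure H facetH)))))
    overLink : ∀ {y} → y ∈ₛ lk x X → FacetsOverJoined (StrongStep d) T X (x ∪ y)
    overLink {y} y∈lk =
      facetsOverFace′ k (up x∈T (proj₂ (proj₂ (∈-lk⁻ y∈lk))) (p⊆p∪q y))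
        (≤-trans d≤∣x∣+1+k (≤-trans (≤-reflexive (+-suc ∣ x ∣ k))
          (+-monoˡ-≤ k (p⊂q⇒∣p∣<∣q∣ (∈-lk⇒⊂∪ complex y∈lk)))))

  facetsOverFace : ∀ {x} → x ∈ₛ T → FacetsOverJoined (StrongStep d) T X x
  facetsOverFace {x} x∈T = facetsOverFace′ d x∈T (m≤n+m d ∣ x ∣)

linkCondition⇒normal : ∀ {n d} {X : SSet n} → Complex X → Pure d X → 1 ≤ d →
                       StronglyConnected d X → LinkCondition d X → Normal d X
linkCondition⇒normal complex pure 1≤d stronglyConnected LC =
  StronglyConnected⇒Connected stronglyConnected , 1≤d , λ S S-open S-connected →
    (λ F facetF → pure F (Open⇒Facet S-open facetF)) ,
    λ F G facetF facetG →
      joinAlong (λ a → a) (λ a⊆b → a⊆b) (λ a∈S → proj₁ S-open _ a∈S)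
        (LinkCondition⇒Normal.facetsOverFace complex pure LC S-open)
        (S-connected F G (proj₁ facetF) (proj₁ facetG))
        (Open⇒Facet S-open facetF) (Open⇒Facet S-open facetG) ⊆-refl ⊆-refl

module Normal⇒LinkCondition {n d : ℕ} {X : SSet n} (complex : Complex X) (normal : Normal d X)
                            {x : Subset n} (x∈X : x ∈ₛ X) (∣x∣<d : ∣ x ∣ < d) where

  open LinkAndStar X

  private
    star-stronglyConnected : StronglyConnected d (star x)
    star-stronglyConnected = proj₂ (proj₂ normal) (star x) (star-open x) (star-connected x∈X)

    ─x∈lk : ∀ {a} → a ∈ₛ star x → d ≤ ∣ a ∣ → a ─ x ∈ₛ lk x X
    ─x∈lk a∈St d≤∣a∣ with ∈-star⁻ x a∈St
    ... | a∈X , x⊆a = ─∈lk complex (⊆∧∣p∣<∣q∣⇒⊂ x⊆a (<-≤-trans ∣x∣<d d≤∣a∣)) a∈X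

  -- Every face after the first on a strong d-path has at least d > ∣ x ∣
  -- vertices, so a ─ x stays nonempty.
  starPath⇒lkPath : ∀ {a b} → Path (StrongStep d) (star x) a b → d ≤ ∣ a ∣ →
                    Path Comparable (lk x X) (a ─ x) (b ─ x)
  starPath⇒lkPath (stop a∈St) d≤∣a∣ = stop (─x∈lk a∈St d≤∣a∣)
  starPath⇒lkPath (step a∈St a~b rest) d≤∣a∣ =
    step (─x∈lk a∈St d≤∣a∣) (─-comparable (StrongStep⇒Comparable a~b))
      (starPath⇒lkPath rest (StrongStep⇒d≤∣target∣ a~b))
    where
    ─-comparable : ∀ {a b} → Comparable a b → Comparable (a ─ x) (b ─ x)
    ─-comparable (inj₁ a⊆b) = inj₁ (─-monoˡ-⊆ x a⊆b)
    ─-comparable (inj₂ b⊆a) = inj₂ (─-monoˡ-⊆ x b⊆a)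

  lk-connected : Connected (lk x X)
  lk-connected y y′ y∈lk y′∈lk
    with ∈-lk⁻ y∈lk | ∈-lk⁻ y′∈lk
  ... | _ , x∩y≡⊥ , x∪y∈X | _ , x∩y′≡⊥ , x∪y′∈X
    with facetAbove X x∪y∈X | facetAbove X x∪y′∈X
  ... | F , facetF , x∪y⊆F | G , facetG , x∪y′⊆G =
    step y∈lk (inj₁ (p∩q≡⊥⇒q⊆r─p x∩y≡⊥ x∪y⊆F))
      (starPath⇒lkPath (proj₂ star-stronglyConnected F G facetF* facetG*) (d≤∣facet∣ facetF*)
        ++ₚ step (─x∈lk (proj₁ facetG*) (d≤∣facet∣ facetG*))
                 (inj₂ (p∩q≡⊥⇒q⊆r─p x∩y′≡⊥ x∪y′⊆G)) (stop y′∈lk))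
    where
    inStar : ∀ {H z} → Facet X H → x ∪ z ⊆ H → Facet (star x) H
    inStar {z = z} (H∈X , maximal) x∪z⊆H =
      ∈-star⁺ H∈X (⊆-trans (p⊆p∪q z) x∪z⊆H) ,
      λ w w∈St H⊆w → maximal w (proj₁ (∈-star⁻ x w∈St)) H⊆w
    facetF* : Facet (star x) F
    facetF* = inStar facetF x∪y⊆F
    facetG* : Facet (star x) G
    facetG* = inStar facetG x∪y′⊆G
    d≤∣facet∣ : ∀ {H} → Facet (star x) H → d ≤ ∣ H ∣
    d≤∣facet∣ {H} facetH =
      ≤-trans (n≤1+n d) (≤-reflexive (sym (proj₁ star-stronglyConnected H facetH)))

normal⇒linkCondition : ∀ {n d} {X : SSet n} → Complex X → Normal d X → LinkCondition d X
normal⇒linkCondition {d = d} complex normal p x x∈X ∣x∣≡1+p p+2≤d =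
  Normal⇒LinkCondition.lk-connected complex normal x∈X
    (subst (_< d) (sym ∣x∣≡1+p) (subst (_≤ d) (+-comm p 2) p+2≤d))

proposition7 : (n d : ℕ) → 1 ≤ d → (X : SSet n) → Pseudomanifold d X →
    (Normal d X ⇔ LinkCondition d X)
proposition7 n d 1≤d X (complex , pure , _ , stronglyConnected) =
  mk⇔ (normal⇒linkCondition complex) (linkCondition⇒normal complex pure 1≤d stronglyConnected)
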